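{- Let $(G,t)$ be a rooted graph and $e=\{u,v\}$ a link of $G$. Let $\pi$ be a perfectly resilient skipping forwarding pattern for $(G\setminus e,t)$, and let $\pi^*$ be a skipping forwarding pattern for $G$ obtained by inserting $e$ at an arbitrary position into every priority list of $\pi_u$ and of $\pi_v$, leaving the lists $\pi_w$ for $w\notin\{u,v\}$ unchanged. Then for every start node $s$ and every set $F$ of failed links with $e\in F$ such that an $s$-$t$-path exists in $G\setminus F$, the routing corresponding to $\pi^*$, $s$, and $F$ contains $t$.
   Context: Graphs are finite, simple, undirected; $t$ is the target. A skipping forwarding pattern assigns to each node $w\neq t$ and each in-port (a link at $w$, or $\bot$ if the packet starts at $w$) a permutation of the links at $w$ (priority list); the out-port is the first non-failed link of the list. The routing from $s$ under failure set $F$ starts at $s$ (in-port $\bot$) and repeatedly moves along the out-port, the in-port at the next node being the link just traversed; it stops at $t$. A pattern is perfectly resilient for $(H,t)$ if for every $s$ and failure set $F$ with $s,t$ connected in $H$ minus $F$, the routing reaches $t$. -}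

module Defs where

open import Data.Nat using (ℕ; zero; suc)
open import Data.Fin using (Fin)
open import Data.Fin.Properties using (_≟_)
open import Data.Bool using (Bool; true; false; _∧_; _∨_; not; if_then_else_)
open import Data.Bool.Properties using (∨-comm; ∧-comm)
open import Data.List using (List; []; _∷_; filterᵇ; _++_; allFin)
open import Data.List.Relation.Binary.Permutation.Propositional using (_↭_)
open import Data.Maybe using (Maybe; just; nothing)
open import Data.Product using (_×_; _,_; proj₁; ∃; ∃₂)
open import Data.Unit using (⊤)
open import Relation.Nullary using (¬_; does; yes; no)
open import Relation.Binary.PropositionalEquality using (_≡_; _≢_; refl; cong; cong₂; trans)

record Graph (n : ℕ) : Set where
  field
    adj        : Fin n → Fin n → Bool
    adj-sym    : ∀ x y → adj x y ≡ adj y x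
    adj-irrefl : ∀ x → adj x x ≡ false
open Graph public

module _ {n : ℕ} where

  eqᵇ : Fin n → Fin n → Bool
  eqᵇ x y = does (x ≟ y)

  samePair : Fin n → Fin n → Fin n → Fin n → Bool
  samePair u v x y = (eqᵇ x u ∧ eqᵇ y v) ∨ (eqᵇ x v ∧ eqᵇ y u)

  private
    samePair-sym : ∀ u v x y → samePair u v x y ≡ samePair u v y x
    samePair-sym u v x y =
      trans (∨-comm (eqᵇ x u ∧ eqᵇ y v) (eqᵇ x v ∧ eqᵇ y u))
            (cong₂ _∨_ (∧-comm (eqᵇ x v) (eqᵇ y u)) (∧-comm (eqᵇ x u) (eqᵇ y v)))

  removeLink : Graph n → Fin n → Fin n → Graph n
  removeLink G u v = record
    { adj        = λ x y → adj G x y ∧ not (samePair u v x y)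
    ; adj-sym    = λ x y → cong₂ (λ a b → a ∧ not b) (adj-sym G x y) (samePair-sym u v x y)
    ; adj-irrefl = λ x → cong (λ a → a ∧ not (samePair u v x x)) (adj-irrefl G x)
    }

  -- The links at w, each link {w,x} identified (at w) by the neighbour x.
  links : Graph n → Fin n → List (Fin n)
  links G w = filterᵇ (adj G w) (allFin n)

  -- In-ports at w: a link at w (given by the neighbour), or ⊥ (nothing).
  ValidIn : Graph n → Fin n → Maybe (Fin n) → Set
  ValidIn G w nothing  = ⊤
  ValidIn G w (just x) = adj G w x ≡ true

  Pattern : Set
  Pattern = Fin n → Maybe (Fin n) → List (Fin n)

  IsPattern : Graph n → Fin n → Pattern → Set
  IsPattern H t π = ∀ w → w ≢ t → ∀ i → ValidIn H w i → π w i ↭ links H w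

  -- A failure set: a set of (unordered) links, given by a Boolean predicate
  -- (symmetrised in `failed`).
  FailSet : Set
  FailSet = Fin n → Fin n → Bool

  failed : FailSet → Fin n → Fin n → Bool
  failed F x y = F x y ∨ F y x

  _⊆Links_ : FailSet → Graph n → Set
  F ⊆Links H = ∀ x y → F x y ≡ true → adj H x y ≡ true

  data Reach (H : Graph n) (F : FailSet) : Fin n → Fin n → Set where
    here : ∀ {x} → Reach H F x x
    step : ∀ {x y z} → adj H x y ≡ true → failed F x y ≡ false
         → Reach H F y z → Reach H F x z

  firstLive : FailSet → Fin n → List (Fin n) → Maybe (Fin n)
  firstLive F w []       = nothing
  firstLive F w (x ∷ xs) = if failed F w x then firstLive F w xs else just x

  State : Set
  State = Fin n × Maybe (Fin n)

  -- One routing step; the routing stops at t, and stays put (is dropped)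
  -- if no non-failed link is available.
  stepR : Fin n → Pattern → FailSet → State → State
  stepR t π F (w , i) with w ≟ t
  ... | yes _ = (w , i)
  ... | no  _ with firstLive F w (π w i)
  ...   | nothing = (w , i)
  ...   | just x  = (x , just w)

  route : Fin n → Pattern → FailSet → Fin n → ℕ → State
  route t π F s zero    = (s , nothing)
  route t π F s (suc k) = stepR t π F (route t π F s k)

  RoutingContains : Fin n → Pattern → FailSet → Fin n → Set
  RoutingContains t π F s = ∃ λ k → proj₁ (route t π F s k) ≡ t

  PerfectlyResilient : Graph n → Fin n → Pattern → Set
  PerfectlyResilient H t π =
    IsPattern H t π ×
    (∀ s (F : FailSet) → F ⊆Links H → Reach H F s t → RoutingContains t π F s)

  InsertedAt : Graph n → Pattern → Pattern → Fin n → Fin n → Set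
  InsertedAt H π π* w z = ∀ i → ValidIn H w i →
    ∃₂ λ xs ys → (π w i ≡ xs ++ ys) × (π* w i ≡ xs ++ z ∷ ys)

{-# OPTIONS --safe #-}
module Submission where

-- Let H = G ∖ e and F' = F ∩ links(H). Since e ∈ F, the position at which e
-- was inserted into a list of π* is always skipped, and on links of H the
-- failure sets F and F' agree; hence from every state whose in-port is a link
-- of H, π* under F takes the same step as π under F', and that step again
-- enters through a link of H. So the routing of π* under F in G coincides with
-- the routing of π under F' in H. An s-t path of G ∖ F avoids e, so it is a
-- path of H ∖ F', and perfect resilience of π makes that routing reach t.

open import Defs
open import Data.Nat using (ℕ; zero; suc)
open import Data.Fin using (Fin)
open import Data.Fin.Properties using (_≟_)
open import Data.Bool using (true; false; _∧_; _∨_; if_then_else_; T?)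
open import Data.Bool.Properties
  using (∨-comm; ∧-identityʳ; ∧-conicalˡ; ∧-conicalʳ; ∨-conicalˡ; ∨-conicalʳ; T-≡)
open import Data.List using ([]; _∷_; _++_; allFin)
open import Data.List.Membership.Propositional using (_∈_)
open import Data.List.Membership.Propositional.Properties using (∈-filter⁻)
open import Data.List.Relation.Unary.Any using (here; there)
open import Data.List.Relation.Binary.Permutation.Propositional.Properties using (∈-resp-↭)
open import Data.Maybe using (just; nothing)
open import Data.Product using (_×_; _,_; proj₁; proj₂)
open import Data.Sum using (_⊎_; inj₁; inj₂)
open import Data.Unit using (tt)
open import Function using (_∘_)
open import Function.Bundles using (Equivalence)
open import Relation.Nullary using (contradiction; yes; no)
open import Relation.Binary.PropositionalEquality
  using (_≡_; _≢_; refl; sym; trans; cong; cong₂; module ≡-Reasoning)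

module _ {n : ℕ} where

  failed-sym : ∀ (F : FailSet {n}) x y → failed F x y ≡ failed F y x
  failed-sym F x y = ∨-comm (F x y) (F y x)

  eqᵇ-∧-true : ∀ {x y a b : Fin n} → eqᵇ x a ∧ eqᵇ y b ≡ true → x ≡ a × y ≡ b
  eqᵇ-∧-true {x} {y} {a} {b} h with x ≟ a | y ≟ b | h
  ... | yes x≡a | yes y≡b | _ = x≡a , y≡b
  ... | yes _   | no _    | ()
  ... | no _    | _       | ()

  samePair-true : ∀ {u v x y : Fin n} → samePair u v x y ≡ true →
    (x ≡ u × y ≡ v) ⊎ (x ≡ v × y ≡ u)
  samePair-true {u} {v} {x} {y} h with eqᵇ x u ∧ eqᵇ y v in uv
  ... | true  = inj₁ (eqᵇ-∧-true uv)
  ... | false = inj₂ (eqᵇ-∧-true h)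

  samePair⇒failed : ∀ {F : FailSet {n}} {u v x y} → failed F u v ≡ true →
    samePair u v x y ≡ true → failed F x y ≡ true
  samePair⇒failed {F} {u} {v} {x} {y} Fuv sp with samePair-true {u} {v} {x} {y} sp
  ... | inj₁ (refl , refl) = Fuv
  ... | inj₂ (refl , refl) = trans (failed-sym F v u) Fuv

  adj-removeLink : ∀ {G : Graph n} {F : FailSet} {u v x y} → failed F u v ≡ true →
    adj G x y ≡ true → failed F x y ≡ false → adj (removeLink G u v) x y ≡ true
  adj-removeLink {G} {F} {u} {v} {x} {y} Fuv xy Fxy with samePair u v x y in sp
  ... | true  = contradiction (trans (sym (samePair⇒failed {F} Fuv sp)) Fxy) λ ()
  ... | false = trans (∧-identityʳ (adj G x y)) xy

  ValidIn-removeLink : ∀ {G : Graph n} {u v w} i →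
    ValidIn (removeLink G u v) w i → ValidIn G w i
  ValidIn-removeLink nothing  _  = tt
  ValidIn-removeLink (just x) wx = ∧-conicalˡ _ _ wx

  _∩Links_ : FailSet {n} → Graph n → FailSet {n}
  (F ∩Links H) x y = F x y ∧ adj H x y

  ∩Links-⊆Links : ∀ F H → (F ∩Links H) ⊆Links H
  ∩Links-⊆Links F H x y = ∧-conicalʳ (F x y) (adj H x y)

  failed-∩Links : ∀ F H {w x} → adj H w x ≡ true →
    failed F w x ≡ failed (F ∩Links H) w x
  failed-∩Links F H {w} {x} wx = sym (cong₂ _∨_ (restrict wx) (restrict xw))
    where
    restrict : ∀ {a b} → adj H a b ≡ true → F a b ∧ adj H a b ≡ F a b
    restrict ab = trans (cong (F _ _ ∧_) ab) (∧-identityʳ _)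
    xw : adj H x w ≡ true
    xw = trans (adj-sym H x w) wx

  ∩Links-unfailed : ∀ F H {x y} → failed F x y ≡ false → failed (F ∩Links H) x y ≡ false
  ∩Links-unfailed F H {x} {y} Fxy
    rewrite ∨-conicalˡ (F x y) (F y x) Fxy | ∨-conicalʳ (F x y) (F y x) Fxy = refl

  Reach-removeLink : ∀ {G : Graph n} {F : FailSet} {u v s t} → failed F u v ≡ true →
    Reach G F s t → Reach (removeLink G u v) (F ∩Links removeLink G u v) s t
  Reach-removeLink Fuv here = here
  Reach-removeLink {G} {F} Fuv (step xy Fxy r) =
    step (adj-removeLink {G} {F} Fuv xy Fxy) (∩Links-unfailed F (removeLink G _ _) Fxy)
         (Reach-removeLink Fuv r)

  ∈-links⇒adj : ∀ (H : Graph n) {w x} → x ∈ links H w → adj H w x ≡ true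
  ∈-links⇒adj H {w} {x} x∈ =
    Equivalence.to T-≡ (proj₂ (∈-filter⁻ (T? ∘ adj H w) {x} {allFin n} x∈))

  IsPattern-adj : ∀ {H : Graph n} {t π w i x} → IsPattern H t π → w ≢ t → ValidIn H w i →
    x ∈ π w i → adj H w x ≡ true
  IsPattern-adj {H} π-pattern w≢t wi x∈ = ∈-links⇒adj H (∈-resp-↭ (π-pattern _ w≢t _ wi) x∈)

  firstLive-∈ : ∀ {F : FailSet {n}} {w x} l → firstLive F w l ≡ just x → x ∈ l
  firstLive-∈ {F} {w} (y ∷ l) h with failed F w y
  ... | true  = there (firstLive-∈ l h)
  firstLive-∈ (y ∷ l) refl | false = here refl

  firstLive-cong : ∀ {F₁ F₂ : FailSet {n}} {w} l →
    (∀ {x} → x ∈ l → failed F₁ w x ≡ failed F₂ w x) →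
    firstLive F₁ w l ≡ firstLive F₂ w l
  firstLive-cong []      agree = refl
  firstLive-cong (x ∷ l) agree =
    cong₂ (λ b r → if b then r else just x) (agree (here refl)) (firstLive-cong l (agree ∘ there))

  firstLive-skip-failed : ∀ {F : FailSet {n}} {w z} xs ys → failed F w z ≡ true →
    firstLive F w (xs ++ z ∷ ys) ≡ firstLive F w (xs ++ ys)
  firstLive-skip-failed {F} {w} {z} [] ys Fwz =
    cong (λ b → if b then firstLive F w ys else just z) Fwz
  firstLive-skip-failed {F} {w} (x ∷ xs) ys Fwz =
    cong (λ r → if failed F w x then r else just x) (firstLive-skip-failed xs ys Fwz)

  InsertedAt-firstLive : ∀ {H : Graph n} {w z i} π π* (F : FailSet) →
    InsertedAt H π π* w z → failed F w z ≡ true → ValidIn H w i →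
    firstLive F w (π* w i) ≡ firstLive F w (π w i)
  InsertedAt-firstLive {i = i} _ _ _ inserted Fwz wi with inserted i wi
  ... | xs , ys , π≡ , π*≡ rewrite π≡ | π*≡ = firstLive-skip-failed xs ys Fwz

  ValidState : Graph n → State {n} → Set
  ValidState H (w , i) = ValidIn H w i

  stepR-ValidState : ∀ {H : Graph n} {t π} (F : FailSet) → IsPattern H t π →
    ∀ {st} → ValidState H st → ValidState H (stepR t π F st)
  stepR-ValidState {H} {t} {π} F π-pattern {w , i} wi with w ≟ t
  ... | yes _ = wi
  ... | no w≢t with firstLive F w (π w i) in out
  ...   | nothing = wi
  ...   | just x  =
    trans (adj-sym H x w) (IsPattern-adj π-pattern w≢t wi (firstLive-∈ (π w i) out))

  stepR-cong : ∀ {t : Fin n} {π₁ π₂ F₁ F₂ w i} →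
    (w ≢ t → firstLive F₁ w (π₁ w i) ≡ firstLive F₂ w (π₂ w i)) →
    stepR t π₁ F₁ (w , i) ≡ stepR t π₂ F₂ (w , i)
  stepR-cong {t} {w = w} same-out with w ≟ t
  ... | yes _   = refl
  ... | no w≢t rewrite same-out w≢t = refl

  route-simulation : ∀ {t : Fin n} {π₁ π₂ F₁ F₂} (P : State {n} → Set) {s} →
    P (s , nothing) →
    (∀ {st} → P st → P (stepR t π₂ F₂ st)) →
    (∀ {st} → P st → stepR t π₁ F₁ st ≡ stepR t π₂ F₂ st) →
    ∀ k → route t π₁ F₁ s k ≡ route t π₂ F₂ s k
  route-simulation {t} {π₁} {π₂} {F₁} {F₂} P {s} start preserved agree = simulate
    where
    invariant : ∀ k → P (route t π₂ F₂ s k)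
    invariant zero    = start
    invariant (suc k) = preserved (invariant k)

    simulate : ∀ k → route t π₁ F₁ s k ≡ route t π₂ F₂ s k
    simulate zero    = refl
    simulate (suc k) = begin
      stepR t π₁ F₁ (route t π₁ F₁ s k) ≡⟨ cong (stepR t π₁ F₁) (simulate k) ⟩
      stepR t π₁ F₁ (route t π₂ F₂ s k) ≡⟨ agree (invariant k) ⟩
      stepR t π₂ F₂ (route t π₂ F₂ s k) ∎
      where open ≡-Reasoning

module _ {n : ℕ} (G : Graph n) (t u v : Fin n) (π π* : Pattern {n})
  (π-pattern : IsPattern (removeLink G u v) t π)
  (inserted-u : u ≢ t → InsertedAt (removeLink G u v) π π* u v)
  (inserted-v : v ≢ t → InsertedAt (removeLink G u v) π π* v u)
  (unchanged : ∀ w → w ≢ t → w ≢ u → w ≢ v → ∀ i → ValidIn G w i → π* w i ≡ π w i)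
  (F : FailSet {n}) (Fuv : failed F u v ≡ true) where

  private
    H : Graph n
    H = removeLink G u v

  firstLive-π*≡π : ∀ w → w ≢ t → ∀ i → ValidIn H w i →
    firstLive F w (π* w i) ≡ firstLive F w (π w i)
  firstLive-π*≡π w w≢t i wi with w ≟ u | w ≟ v
  ... | yes refl | _        = InsertedAt-firstLive π π* F (inserted-u w≢t) Fuv wi
  ... | no _     | yes refl =
    InsertedAt-firstLive π π* F (inserted-v w≢t) (trans (failed-sym F v u) Fuv) wi
  ... | no w≢u   | no w≢v   =
    cong (firstLive F w) (unchanged w w≢t w≢u w≢v i (ValidIn-removeLink i wi))

  stepR-π*≡stepR-π : ∀ {st} → ValidState H st →
    stepR t π* F st ≡ stepR t π (F ∩Links H) st
  stepR-π*≡stepR-π {w , i} wi = stepR-cong λ w≢t → trans (firstLive-π*≡π w w≢t i wi)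
    (firstLive-cong (π w i) (failed-∩Links F H ∘ IsPattern-adj π-pattern w≢t wi))

lemma6p16 : ∀ {n : ℕ} (G : Graph n) (t u v : Fin n) → adj G u v ≡ true →
    (π π* : Pattern {n}) →
    PerfectlyResilient (removeLink G u v) t π →
    IsPattern G t π* →
    (u ≢ t → InsertedAt (removeLink G u v) π π* u v) →
    (v ≢ t → InsertedAt (removeLink G u v) π π* v u) →
    (∀ w → w ≢ t → w ≢ u → w ≢ v → ∀ i → ValidIn G w i → π* w i ≡ π w i) →
    ∀ (s : Fin n) (F : FailSet {n}) → F ⊆Links G → failed F u v ≡ true →
    Reach G F s t → RoutingContains t π* F s
lemma6p16 G t u v _ π π* (π-pattern , π-resilient) _ inserted-u inserted-v unchanged
  s F _ Fuv s⇝t =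
  let H         = removeLink G u v
      F'        = F ∩Links H
      k , π-hit = π-resilient s F' (∩Links-⊆Links F H) (Reach-removeLink Fuv s⇝t)
      same-route : route t π* F s k ≡ route t π F' s k
      same-route = route-simulation (ValidState H) tt (stepR-ValidState F' π-pattern)
        (stepR-π*≡stepR-π G t u v π π* π-pattern inserted-u inserted-v unchanged F Fuv) k
  in k , trans (cong proj₁ same-route) π-hit
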